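{- If a constraint $C$ is contractible then for every domain $D$, $C$ is monotonic with respect to $D$. Conversely, if $C$ is monotonic with respect to every domain $D$ then $C$ is contractible.
   Context: A global constraint $C$ is a relation on a sequence of variables of arbitrary length. $C$ is contractible if for all $n\ge0$, $C([X_1,\ldots,X_n,Y])\rightarrow C([X_1,\ldots,X_n])$. A domain $D$ assigns each variable a set of values, and $D(\vec{X})$ means every variable of $\vec{X}$ takes a value in its domain. $C$ is monotonic with respect to $D$ if for any pair of disjoint sequences of variables $\vec{X}$ and $\vec{Y}$, $\{\vec{X}\mid C(\vec{X}\vec{Y})\wedge D(\vec{X})\wedge D(\vec{Y})\}\subseteq\{\vec{X}\mid C(\vec{X})\wedge D(\vec{X})\}$ (sets of value assignments to $\vec{X}$). -}

module Defs where

open import Level using (Level; _⊔_; suc)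
open import Data.Nat using (ℕ)
open import Data.List using (List; []; _∷_; _++_; [_])
open import Data.List.Relation.Unary.Unique.Propositional using (Unique)
open import Data.List.Relation.Binary.Disjoint.Propositional using (Disjoint)
open import Data.List.Relation.Binary.Pointwise using (Pointwise)

-- Variables are drawn from a countably infinite supply (ℕ), so that
-- sequences of variables of arbitrary length exist.
Var : Set
Var = ℕ

Constraint : ∀ {a} → Set a → (ℓ : Level) → Set (a ⊔ Level.suc ℓ)
Constraint A ℓ = List A → Set ℓ

Domain : ∀ {a} → Set a → (ℓ : Level) → Set (a ⊔ Level.suc ℓ)
Domain A ℓ = Var → A → Set ℓ

InDomain : ∀ {a ℓ} {A : Set a} → Domain A ℓ → List Var → List A → Set (a ⊔ ℓ)
InDomain D Xs xs = Pointwise D Xs xs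

Contractible : ∀ {a ℓ} {A : Set a} → Constraint A ℓ → Set (a ⊔ ℓ)
Contractible {A = A} C = ∀ (xs : List A) (y : A) → C (xs ++ [ y ]) → C xs

Monotonic : ∀ {a ℓ ℓ'} {A : Set a} → Constraint A ℓ → Domain A ℓ' → Set (a ⊔ ℓ ⊔ ℓ')
Monotonic {A = A} C D =
  ∀ (Xs Ys : List Var) → Unique (Xs ++ Ys) → Disjoint Xs Ys →
  ∀ (xs ys : List A) →
  C (xs ++ ys) → InDomain D Xs xs → InDomain D Ys ys →
  C xs × InDomain D Xs xs
  where open import Data.Product using (_×_)

module Submission where

open import Defs
open import Level using (Level; Lift; lift)
open import Data.Product using (_×_; _,_; proj₁)
open import Data.Nat using (ℕ; suc)
open import Data.Nat.Properties using (<-irrefl)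
open import Data.List using ([]; _∷_; _++_; [_]; length; upTo)
open import Data.List.Properties using (++-identityʳ; ++-assoc; length-upTo; upTo-∷ʳ)
open import Data.List.Relation.Unary.Any using (here)
open import Data.List.Relation.Unary.Unique.Propositional using (Unique)
open import Data.List.Relation.Unary.Unique.Propositional.Properties using (upTo⁺)
open import Data.List.Relation.Binary.Disjoint.Propositional using (Disjoint)
open import Data.List.Relation.Binary.Pointwise using (lookup⁻; _∷_; [])
open import Data.List.Membership.Propositional.Properties using (∈-upTo⁻)
open import Data.Unit using (⊤; tt)
open import Relation.Binary.PropositionalEquality using (subst; sym)

module _ {a ℓ} {A : Set a} {C : Constraint A ℓ} (contractible : Contractible C) where

  contractible⇒++-dropʳ : ∀ xs ys → C (xs ++ ys) → C xs
  contractible⇒++-dropʳ xs []       c = subst C (++-identityʳ xs) c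
  contractible⇒++-dropʳ xs (y ∷ ys) c =
    contractible xs y
      (contractible⇒++-dropʳ (xs ++ [ y ]) ys (subst C (sym (++-assoc xs [ y ] ys)) c))

  contractible⇒monotonic : ∀ {ℓ'} (D : Domain A ℓ') → Monotonic C D
  contractible⇒monotonic D _ _ _ _ xs ys c xs∈D _ = contractible⇒++-dropʳ xs ys c , xs∈D

Unconstrained : ∀ {a} {A : Set a} (ℓ' : Level) → Domain A ℓ'
Unconstrained ℓ' _ _ = Lift ℓ' ⊤

upTo-disjoint-[n] : ∀ n → Disjoint (upTo n) [ n ]
upTo-disjoint-[n] n (v∈upTo , here v≡n) = <-irrefl v≡n (∈-upTo⁻ v∈upTo)

-- To contract C(xs ++ [y]), read xs as the values of the variables 0, …, n-1 and y as that of n,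
-- all in the domain imposing no restriction.
monotonic⇒contractible : ∀ {a ℓ} (ℓ' : Level) {A : Set a} {C : Constraint A ℓ} →
                         (∀ (D : Domain A ℓ') → Monotonic C D) → Contractible C
monotonic⇒contractible ℓ' monotonic xs y c =
  proj₁ (monotonic (Unconstrained ℓ') (upTo n) [ n ] unique (upTo-disjoint-[n] n)
           xs [ y ] c (lookup⁻ (length-upTo n) (λ _ → lift tt)) (lift tt ∷ []))
  where
  n : ℕ
  n = length xs
  unique : Unique (upTo n ++ [ n ])
  unique = subst Unique (sym (upTo-∷ʳ n)) (upTo⁺ (suc n))

proposition2 : ∀ {a ℓ} (ℓ' : Level) {A : Set a} (C : Constraint A ℓ) →
    (Contractible C → ∀ (D : Domain A ℓ') → Monotonic C D)
    × ((∀ (D : Domain A ℓ') → Monotonic C D) → Contractible C)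
proposition2 ℓ' C = (λ contractible → contractible⇒monotonic contractible) , monotonic⇒contractible ℓ'
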